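{- Let $a>1$ be odd. If for some integers $r_t>r_{t-1}>\dots>r_1\geq 0$ we have $x_{2^{r_1}}^{(a)}=2^{r_t}+2^{r_{t-1}}+\dots+2^{r_1}$, then there exists $T=T(r_1,\dots,r_t)$ such that $x_{2^T}^{(a)}=3\cdot 2^T$.
   Context: For a positive integer $m$, let $\nu_2(m)$ be the exponent of the highest power of $2$ dividing $m$. For an odd integer $a>1$, define $x_1^{(a)}=a$ and, for $n\ge2$, $x_n^{(a)}$ is the smallest integer $y>x_{n-1}^{(a)}$ with $\nu_2(y)=\nu_2(n)$. -}

module Defs where

open import Data.Nat using (ℕ; zero; suc; _+_; _*_; _∸_; _^_; _<_; _≤_)
open import Data.Nat.DivMod using (_/_; _%_)
open import Data.Bool using (if_then_else_)
open import Data.Product using (_×_)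
open import Relation.Binary.PropositionalEquality using (_≡_; _≢_)
open import Relation.Nullary.Decidable using (⌊_⌋)
open import Data.Nat using (_≟_)

ν₂-go : ℕ → ℕ → ℕ
ν₂-go zero    m = zero
ν₂-go (suc f) m =
  if ⌊ m ≟ 0 ⌋ then 0
  else (if ⌊ m % 2 ≟ 0 ⌋ then suc (ν₂-go f (m / 2)) else 0)

-- ν₂ m = exponent of the highest power of 2 dividing m (for m > 0);
-- fuel m suffices since m halves at each step.  (ν₂ 0 = 0, never used.)
ν₂ : ℕ → ℕ
ν₂ m = ν₂-go m m

-- IsSeq a x : x is the sequence x^(a)_n (values at n ≥ 1; x 0 is irrelevant):
-- x 1 = a, and for n ≥ 2, x n is the smallest y > x (n-1) with ν₂ y = ν₂ n.
record IsSeq (a : ℕ) (x : ℕ → ℕ) : Set where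
  field
    base : x 1 ≡ a
    step-gt  : ∀ n → 2 ≤ n → x (n ∸ 1) < x n
    step-val : ∀ n → 2 ≤ n → ν₂ (x n) ≡ ν₂ n
    step-min : ∀ n → 2 ≤ n → ∀ y → x (n ∸ 1) < y → y < x n → ν₂ y ≢ ν₂ n

{-# OPTIONS --safe #-}
-- If x(2^k) = 2^k (2q+1), then for 0 < j < 2^k both x(2^k) + j and 2^k + j have
-- 2-adic valuation ν₂(j), so the sequence simply counts up: x(2^k + j) = x(2^k) + j.
-- Hence x(2^(k+1)) is the least 2^(k+1) (2r+1) exceeding 2^(k+1) (q+1) - 1, which
-- forces r ≤ ⌈q/2⌉ < q as soon as q ≥ 2. Starting from x(1) = a = 2^0 (2q+1), the
-- index q therefore decreases until q = 1, i.e. x(2^T) = 3 · 2^T; q = 0 cannot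
-- occur because x(n) > n.
module Submission where

open import Defs
open import Data.Nat using (ℕ; _+_; _*_; _^_; _<_; _%_)
open import Data.List using (List; _∷_; map)
open import Data.Nat.ListAction using (sum)
open import Data.List.Relation.Unary.Linked using (Linked)
open import Data.Product using (∃)
open import Relation.Binary.PropositionalEquality using (_≡_)

open import Data.Nat
open import Data.Nat.Properties
open import Data.Nat.DivMod
open import Data.Nat.Induction using (<-rec)
open import Data.Nat.Tactic.RingSolver using (solve-∀)
open import Data.Product using (∃₂; _×_; _,_)
open import Data.Sum using (_⊎_; inj₁; inj₂)
open import Relation.Binary.PropositionalEquality
open import Relation.Nullary using (contradiction)

1+2*q%2≡1 : ∀ q → (1 + 2 * q) % 2 ≡ 1
1+2*q%2≡1 q = trans (cong (λ m → suc m % 2) (*-comm 2 q)) ([m+kn]%n≡m%n 1 q 2)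

ν₂-go-odd : ∀ f q → ν₂-go (suc f) (1 + 2 * q) ≡ 0
ν₂-go-odd f q rewrite 1+2*q%2≡1 q = refl

ν₂-go-double : ∀ f m → .{{NonZero m}} → ν₂-go (suc f) (m * 2) ≡ suc (ν₂-go f m)
ν₂-go-double f m@(suc _) rewrite m*n%n≡0 m 2 {{_}} | m*n/n≡m m 2 {{_}} = refl

n<2^n : ∀ n → n < 2 ^ n
n<2^n zero    = z<s
n<2^n (suc n) = +-mono-≤-< (m^n>0 2 n) (subst (n <_) (sym (+-identityʳ (2 ^ n))) (n<2^n n))

ν₂-go-2^i*odd : ∀ f i q → i < f → ν₂-go f (2 ^ i * (1 + 2 * q)) ≡ i
ν₂-go-2^i*odd (suc f) zero    q _ = trans (cong (ν₂-go (suc f)) (*-identityˡ (1 + 2 * q))) (ν₂-go-odd f q)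
ν₂-go-2^i*odd (suc f) (suc i) q (s<s i<f) = begin
  ν₂-go (suc f) (2 ^ suc i * o)  ≡⟨ cong (ν₂-go (suc f)) 2^[1+i]*o≡2^i*o*2 ⟩
  ν₂-go (suc f) (2 ^ i * o * 2)  ≡⟨ ν₂-go-double f (2 ^ i * o) {{m*n≢0 (2 ^ i) o {{m^n≢0 2 i}}}} ⟩
  suc (ν₂-go f (2 ^ i * o))      ≡⟨ cong suc (ν₂-go-2^i*odd f i q i<f) ⟩
  suc i                          ∎
  where
  open ≡-Reasoning
  o = 1 + 2 * q
  2^[1+i]*o≡2^i*o*2 : 2 ^ suc i * o ≡ 2 ^ i * o * 2
  2^[1+i]*o≡2^i*o*2 = trans (*-assoc 2 (2 ^ i) o) (*-comm 2 (2 ^ i * o))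

ν₂-2^i*odd : ∀ i q → ν₂ (2 ^ i * (1 + 2 * q)) ≡ i
ν₂-2^i*odd i q = ν₂-go-2^i*odd _ i q (≤-trans (n<2^n i) (m≤m*n (2 ^ i) (1 + 2 * q)))

ν₂[2^n]≡n : ∀ n → ν₂ (2 ^ n) ≡ n
ν₂[2^n]≡n n = trans (cong ν₂ (sym (*-identityʳ (2 ^ n)))) (ν₂-2^i*odd n 0)

even-or-odd : ∀ n → ∃ λ h → n ≡ 2 * h ⊎ n ≡ 1 + 2 * h
even-or-odd zero = 0 , inj₁ refl
even-or-odd (suc n) with even-or-odd n
... | h , inj₁ n≡2h   = h , inj₂ (cong suc n≡2h)
... | h , inj₂ n≡1+2h = suc h , inj₁ (trans (cong suc n≡1+2h) (sym (*-suc 2 h)))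

2-adic-decomposition : ∀ n → 0 < n → ∃₂ λ i q → n ≡ 2 ^ i * (1 + 2 * q)
2-adic-decomposition = <-rec _ decompose
  where
  decompose : ∀ n → (∀ {m} → m < n → 0 < m → ∃₂ λ i q → m ≡ 2 ^ i * (1 + 2 * q))
            → 0 < n → ∃₂ λ i q → n ≡ 2 ^ i * (1 + 2 * q)
  decompose n rec n>0 with even-or-odd n
  ... | h , inj₂ n≡1+2h = 0 , h , trans n≡1+2h (sym (*-identityˡ _))
  ... | zero , inj₁ n≡0 = contradiction (sym n≡0) (<⇒≢ n>0)
  ... | h@(suc _) , inj₁ n≡2h with rec (subst (h <_) (sym n≡2h) (m<m+n h z<s)) z<s
  ...   | i , q , h≡2^i*o = suc i , q , trans n≡2h (trans (cong (2 *_) h≡2^i*o) (sym (*-assoc 2 (2 ^ i) _)))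

ν₂≡⇒≡2^*odd : ∀ {w e} → 0 < w → ν₂ w ≡ e → ∃ λ q → w ≡ 2 ^ e * (1 + 2 * q)
ν₂≡⇒≡2^*odd w>0 ν₂w≡e with 2-adic-decomposition _ w>0
... | i , q , refl with trans (sym (ν₂-2^i*odd i q)) ν₂w≡e
...   | refl = q , refl

ν₂[2^k*m+j]≡ν₂[j] : ∀ k m j → 0 < j → j < 2 ^ k → ν₂ (2 ^ k * m + j) ≡ ν₂ j
ν₂[2^k*m+j]≡ν₂[j] k m j j>0 j<2^k with 2-adic-decomposition j j>0
... | i , q , refl with m≤n⇒∃[o]m+o≡n i<k
  where
  i<k : i < k
  i<k = ≰⇒> λ k≤i → <⇒≱ j<2^k (≤-trans (^-monoʳ-≤ 2 k≤i) (m≤m*n (2 ^ i) (1 + 2 * q)))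
...   | d , refl = begin
  ν₂ (2 ^ (suc i + d) * m + 2 ^ i * (1 + 2 * q))  ≡⟨ cong (λ p → ν₂ (p * m + 2 ^ i * (1 + 2 * q))) (^-distribˡ-+-* 2 (suc i) d) ⟩
  ν₂ (2 * 2 ^ i * 2 ^ d * m + 2 ^ i * (1 + 2 * q)) ≡⟨ cong ν₂ (factor-2^i (2 ^ i) (2 ^ d) m q) ⟩
  ν₂ (2 ^ i * (1 + 2 * (q + 2 ^ d * m)))           ≡⟨ ν₂-2^i*odd i (q + 2 ^ d * m) ⟩
  i                                                ≡⟨ ν₂-2^i*odd i q ⟨
  ν₂ (2 ^ i * (1 + 2 * q))                         ∎
  where
  open ≡-Reasoning
  factor-2^i : ∀ A B m q → 2 * A * B * m + A * (1 + 2 * q) ≡ A * (1 + 2 * (q + B * m))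
  factor-2^i = solve-∀

module _ {a x} (S : IsSeq a x) (1<a : 1 < a) where
  open IsSeq S

  n<x[n] : ∀ n → 0 < n → n < x n
  n<x[n] (suc zero)    _ = subst (1 <_) (sym base) 1<a
  n<x[n] (suc (suc n)) _ = <-≤-trans (s<s (n<x[n] (suc n) z<s)) (step-gt (suc (suc n)) (s≤s (s≤s z≤n)))

  x-least : ∀ n {y} → 2 ≤ n → x (n ∸ 1) < y → ν₂ y ≡ ν₂ n → x n ≤ y
  x-least n 2≤n x[n-1]<y ν₂y≡ν₂n = ≮⇒≥ λ y<x[n] → step-min n 2≤n _ x[n-1]<y y<x[n] ν₂y≡ν₂n

  module _ {k q} (x[2^k]≡ : x (2 ^ k) ≡ 2 ^ k * (1 + 2 * q)) where

    x[2^k+j]≡x[2^k]+j : ∀ j → j < 2 ^ k → x (2 ^ k + j) ≡ x (2 ^ k) + j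
    x[2^k+j]≡x[2^k]+j zero    _ = trans (cong x (+-identityʳ _)) (sym (+-identityʳ _))
    x[2^k+j]≡x[2^k]+j (suc j) j<2^k = begin
      x (2 ^ k + suc j)       ≡⟨ cong x (+-suc _ j) ⟩
      x (suc (2 ^ k + j))     ≡⟨ ≤-antisym (x-least _ 2≤n (n<1+n _) ν₂-agrees) (step-gt _ 2≤n) ⟩
      suc (x (2 ^ k + j))     ≡⟨ cong suc ih ⟩
      suc (x (2 ^ k) + j)     ≡⟨ +-suc _ j ⟨
      x (2 ^ k) + suc j       ∎
      where
      open ≡-Reasoning
      ih : x (2 ^ k + j) ≡ x (2 ^ k) + j
      ih = x[2^k+j]≡x[2^k]+j j (<-trans (n<1+n j) j<2^k)
      2≤n : 2 ≤ suc (2 ^ k + j)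
      2≤n = s≤s (≤-trans (m^n>0 2 k) (m≤m+n _ j))
      ν₂-agrees : ν₂ (suc (x (2 ^ k + j))) ≡ ν₂ (suc (2 ^ k + j))
      ν₂-agrees = begin
        ν₂ (suc (x (2 ^ k + j)))         ≡⟨ cong (λ v → ν₂ (suc v)) (trans ih (cong (_+ j) x[2^k]≡)) ⟩
        ν₂ (suc (2 ^ k * (1 + 2 * q) + j)) ≡⟨ cong ν₂ (+-suc (2 ^ k * (1 + 2 * q)) j) ⟨
        ν₂ (2 ^ k * (1 + 2 * q) + suc j) ≡⟨ ν₂[2^k*m+j]≡ν₂[j] k (1 + 2 * q) (suc j) z<s j<2^k ⟩
        ν₂ (suc j)                       ≡⟨ ν₂[2^k*m+j]≡ν₂[j] k 1 (suc j) z<s j<2^k ⟨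
        ν₂ (2 ^ k * 1 + suc j)           ≡⟨ cong (λ p → ν₂ (p + suc j)) (*-identityʳ (2 ^ k)) ⟩
        ν₂ (2 ^ k + suc j)               ≡⟨ cong ν₂ (+-suc (2 ^ k) j) ⟩
        ν₂ (suc (2 ^ k + j))             ∎

    x[2^[1+k]]≡2^[1+k]*odd : ∃ λ r → x (2 ^ suc k) ≡ 2 ^ suc k * (1 + 2 * r) × r ≤ ⌈ q /2⌉
    x[2^[1+k]]≡2^[1+k]*odd =
      let r , x[N]≡ = ν₂≡⇒≡2^*odd (<-trans N>0 (n<x[n] N N>0)) (trans (step-val N 2≤N) (ν₂[2^n]≡n (suc k)))
      in r , x[N]≡ , *-cancelˡ-≤ 2 (s≤s⁻¹ (*-cancelˡ-≤ N {{m^n≢0 2 (suc k)}} (subst (_≤ y) x[N]≡ x[N]≤y)))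
      where
      N = 2 ^ suc k
      N>0 : 0 < N
      N>0 = m^n>0 2 (suc k)
      2≤N : 2 ≤ N
      2≤N = *-monoʳ-≤ 2 (m^n>0 2 k)
      c = ⌈ q /2⌉
      y = N * (1 + 2 * c)
      q≤2c : q ≤ 2 * c
      q≤2c = begin
        q            ≡⟨ ⌊n/2⌋+⌈n/2⌉≡n q ⟨
        ⌊ q /2⌋ + c  ≤⟨ +-monoˡ-≤ c (⌊n/2⌋≤⌈n/2⌉ q) ⟩
        c + c        ≡⟨ cong (c +_) (+-identityʳ c) ⟨
        2 * c        ∎
        where open ≤-Reasoning
      2^k∸1<2^k : 2 ^ k ∸ 1 < 2 ^ k
      2^k∸1<2^k = ∸-monoʳ-< z<s (m^n>0 2 k)
      N∸1≡2^k+[2^k∸1] : N ∸ 1 ≡ 2 ^ k + (2 ^ k ∸ 1)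
      N∸1≡2^k+[2^k∸1] = trans (cong (λ p → 2 ^ k + p ∸ 1) (+-identityʳ (2 ^ k))) (+-∸-assoc (2 ^ k) (m^n>0 2 k))
      A*o+A≡2A*[1+q] : ∀ A q → A * (1 + 2 * q) + A ≡ 2 * A * (1 + q)
      A*o+A≡2A*[1+q] = solve-∀
      x[N∸1]<y : x (N ∸ 1) < y
      x[N∸1]<y = begin-strict
        x (N ∸ 1)                    ≡⟨ cong x N∸1≡2^k+[2^k∸1] ⟩
        x (2 ^ k + (2 ^ k ∸ 1))      ≡⟨ x[2^k+j]≡x[2^k]+j _ 2^k∸1<2^k ⟩
        x (2 ^ k) + (2 ^ k ∸ 1)      <⟨ +-monoʳ-< (x (2 ^ k)) 2^k∸1<2^k ⟩
        x (2 ^ k) + 2 ^ k            ≡⟨ cong (_+ 2 ^ k) x[2^k]≡ ⟩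
        2 ^ k * (1 + 2 * q) + 2 ^ k  ≡⟨ A*o+A≡2A*[1+q] (2 ^ k) q ⟩
        N * (1 + q)                  ≤⟨ *-monoʳ-≤ N (s≤s q≤2c) ⟩
        y                            ∎
        where open ≤-Reasoning
      x[N]≤y : x N ≤ y
      x[N]≤y = x-least N 2≤N x[N∸1]<y (trans (ν₂-2^i*odd (suc k) c) (sym (ν₂[2^n]≡n (suc k))))

  x[2^k]≡2^k*odd⇒∃x[2^T]≡3*2^T : ∀ q k → x (2 ^ k) ≡ 2 ^ k * (1 + 2 * q) → ∃ λ T → x (2 ^ T) ≡ 3 * 2 ^ T
  x[2^k]≡2^k*odd⇒∃x[2^T]≡3*2^T = <-rec _ descend
    where
    descend : ∀ q → (∀ {r} → r < q → ∀ k → x (2 ^ k) ≡ 2 ^ k * (1 + 2 * r) → ∃ λ T → x (2 ^ T) ≡ 3 * 2 ^ T)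
            → ∀ k → x (2 ^ k) ≡ 2 ^ k * (1 + 2 * q) → ∃ λ T → x (2 ^ T) ≡ 3 * 2 ^ T
    descend zero             _   k x[2^k]≡ = contradiction (trans x[2^k]≡ (*-identityʳ _)) (≢-sym (<⇒≢ (n<x[n] _ (m^n>0 2 k))))
    descend (suc zero)       _   k x[2^k]≡ = k , trans x[2^k]≡ (*-comm (2 ^ k) 3)
    descend q@(suc (suc q′)) rec k x[2^k]≡ =
      let r , x[2^[1+k]]≡ , r≤⌈q/2⌉ = x[2^[1+k]]≡2^[1+k]*odd {k} {q} x[2^k]≡
      in rec (≤-<-trans r≤⌈q/2⌉ (⌈n/2⌉<n q′)) (suc k) x[2^[1+k]]≡

lemma3 : ∀ (a : ℕ) → a % 2 ≡ 1 → 1 < a →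
         ∀ (x : ℕ → ℕ) → IsSeq a x →
         ∀ (r₁ : ℕ) (rs : List ℕ) → Linked _<_ (r₁ ∷ rs) →
         x (2 ^ r₁) ≡ sum (map (2 ^_) (r₁ ∷ rs)) →
         ∃ λ T → x (2 ^ T) ≡ 3 * 2 ^ T
lemma3 a a%2≡1 1<a x S _ _ _ _ = x[2^k]≡2^k*odd⇒∃x[2^T]≡3*2^T S 1<a (a / 2) 0 x[1]≡1*odd
  where
  x[1]≡1*odd : x 1 ≡ 1 * (1 + 2 * (a / 2))
  x[1]≡1*odd = begin
    x 1                   ≡⟨ IsSeq.base S ⟩
    a                     ≡⟨ m≡m%n+[m/n]*n a 2 ⟩
    a % 2 + a / 2 * 2     ≡⟨ cong₂ _+_ a%2≡1 (*-comm (a / 2) 2) ⟩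
    1 + 2 * (a / 2)       ≡⟨ *-identityˡ _ ⟨
    1 * (1 + 2 * (a / 2)) ∎
    where open ≡-Reasoning
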